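{- For a rational number $a$ and a positive integer $n$, let $K_{a,n}(x)=x^n+(1-x)^n+a^n\in\mathbb{Q}[x]$. The following are equivalent: (i) there exist a rational number $a\notin\{0,-1\}$ and an odd positive integer $n$ such that $K_{a,n}$ has a rational root; (ii) there exist an integer $m>2$ and positive integers $X,Y,Z$ with $X^m+Y^m=Z^m$. -}

module Defs where

open import Data.Nat using (ℕ; zero; suc; _*_)
open import Data.Rational using (ℚ; 0ℚ; 1ℚ) renaming (_*_ to _*ℚ_; _+_ to _+ℚ_; _-_ to _-ℚ_)
open import Data.Product using (∃-syntax)
open import Relation.Binary.PropositionalEquality using (_≡_)

_^ℚ_ : ℚ → ℕ → ℚ
q ^ℚ zero  = 1ℚ
q ^ℚ suc n = q *ℚ (q ^ℚ n)

K : ℚ → ℕ → ℚ → ℚ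
K a n x = (x ^ℚ n) +ℚ ((1ℚ -ℚ x) ^ℚ n) +ℚ (a ^ℚ n)

IsOdd : ℕ → Set
IsOdd n = ∃[ k ] n ≡ suc (2 * k)

module Submission where

-- Clearing denominators turns a rational root x of K_{a,n} with a ∉ {0, -1} into integers
-- (u, v, w) = t (x, 1 - x, a) with u^n + v^n + w^n = 0, w ≠ 0 and u + v + w ≠ 0; conversely such
-- integers give the root x = u/(u+v) for a = w/(u+v).  For odd n the condition u + v + w ≠ 0 rules
-- out n = 1 and, odd powers being injective, also u = 0 and v = 0; comparing signs, |u|, |v|, |w| in
-- some order solve X^n + Y^n = Z^n.  Conversely a Fermat solution for m > 2 gives one for an odd
-- divisor n > 2 of m, because 4 ∤ m: a solution for exponent 4 would solve x⁴ + y⁴ = z², which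
-- Fermat's infinite descent excludes.

open import Defs

module Fermat where

  open import Data.Nat
  open import Data.Nat.Properties
  open import Data.Nat.Divisibility
  open import Data.Nat.DivMod using (m/n*n≡m)
  open import Data.Nat.Induction using (<-rec)
  open import Data.Nat.GCD
  open import Data.Nat.Coprimality using (Coprime; coprime-divisor; coprime⇒gcd≡1; gcd≡1⇒coprime; coprime-/gcd)
    renaming (sym to coprime-sym)
  open import Data.Nat.Tactic.RingSolver using (solve; solve-∀)
  open import Data.List using (_∷_; [])
  open import Data.Product using (∃-syntax; _×_; _,_)
  open import Data.Sum using (_⊎_; inj₁; inj₂)
  open import Data.Empty using (⊥-elim)
  open import Function using (_∘_)
  open import Relation.Nullary using (¬_; yes; no)
  open import Relation.Binary.Definitions using (tri<; tri≈; tri>)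
  open import Relation.Binary.PropositionalEquality

  private variable a b c m n o u v w : ℕ

  IsEven : ℕ → Set
  IsEven n = ∃[ k ] n ≡ 2 * k

  even⊎odd : ∀ n → IsEven n ⊎ IsOdd n
  even⊎odd zero    = inj₁ (0 , refl)
  even⊎odd (suc n) with even⊎odd n
  ... | inj₁ (k , refl) = inj₂ (k , refl)
  ... | inj₂ (k , refl) = inj₁ (suc k , sym (*-suc 2 k))

  odd⇒¬even : IsOdd n → ¬ IsEven n
  odd⇒¬even (k , refl) (j , eq) = even≢odd j k (sym eq)

  even-square : IsEven n → IsEven (n * n)
  even-square (k , refl) = 2 * (k * k) , solve (k ∷ [])

  odd-square : IsOdd n → IsOdd (n * n)
  odd-square (k , refl) = 2 * (k * k + k) , solve (k ∷ [])

  odd-square⇒odd : IsOdd (n * n) → IsOdd n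
  odd-square⇒odd {n} odd[n²] with even⊎odd n
  ... | inj₁ even = ⊥-elim (odd⇒¬even odd[n²] (even-square even))
  ... | inj₂ odd  = odd

  even-square⇒even : IsEven (n * n) → IsEven n
  even-square⇒even {n} even[n²] with even⊎odd n
  ... | inj₁ even = even
  ... | inj₂ odd  = ⊥-elim (odd⇒¬even (odd-square odd) even[n²])

  square-mod-4 : ∀ c → ∃[ k ] (c * c ≡ 2 * (2 * k) ⊎ c * c ≡ suc (2 * (2 * k)))
  square-mod-4 c with even⊎odd c
  ... | inj₁ (k , refl) = k * k , inj₁ (solve (k ∷ []))
  ... | inj₂ (k , refl) = k * k + k , inj₂ (solve (k ∷ []))

  odd-square-sum : IsOdd a → IsOdd b → ∃[ s ] a * a + b * b ≡ 2 * suc (2 * s)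
  odd-square-sum (i , refl) (j , refl) = i * i + i + (j * j + j) , solve (i ∷ j ∷ [])

  odd-square-sum≢square : IsOdd a → IsOdd b → a * a + b * b ≢ c * c
  odd-square-sum≢square {c = c} odd-a odd-b eq with odd-square-sum odd-a odd-b | square-mod-4 c
  ... | s , sum≡ | k , inj₁ c²≡4k   = even≢odd k s (sym (*-cancelˡ-≡ _ _ 2 (trans (sym sum≡) (trans eq c²≡4k))))
  ... | s , sum≡ | k , inj₂ c²≡4k+1 = even≢odd (suc (2 * s)) (2 * k) (trans (sym sum≡) (trans eq c²≡4k+1))

  square-cancel-≤ : m * m ≤ n * n → m ≤ n
  square-cancel-≤ {m} {n} m²≤n² with m ≤? n
  ... | yes m≤n = m≤n
  ... | no  m≰n = let n<m = ≰⇒> m≰n in ⊥-elim (<⇒≱ (*-mono-< n<m n<m) m²≤n²)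

  square-injective : m * m ≡ n * n → m ≡ n
  square-injective eq = ≤-antisym (square-cancel-≤ (≤-reflexive eq)) (square-cancel-≤ (≤-reflexive (sym eq)))

  coprime-* : Coprime a b → Coprime a c → Coprime a (b * c)
  coprime-* a⊥b a⊥c (d∣a , d∣bc) =
    a⊥c (d∣a , coprime-divisor (λ (e∣d , e∣b) → a⊥b (∣-trans e∣d d∣a , e∣b)) d∣bc)

  coprime-square : Coprime a b → Coprime (a * a) (b * b)
  coprime-square {a} {b} a⊥b = coprime-sym (coprime-* b²⊥a b²⊥a)
    where
    b²⊥a : Coprime (b * b) a
    b²⊥a = coprime-sym (coprime-* a⊥b a⊥b)

  square-* : ∀ m n → m * n * (m * n) ≡ m * m * (n * n)
  square-* = solve-∀

  gcd-square : ∀ a b → gcd (a * a) (b * b) ≡ gcd a b * gcd a b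
  gcd-square a b with gcd a b ≟ 0
  ... | yes g≡0 = begin
    gcd (a * a) (b * b)   ≡⟨ cong₂ (λ x y → gcd (x * x) (y * y)) (gcd[m,n]≡0⇒m≡0 {a} g≡0) (gcd[m,n]≡0⇒n≡0 a g≡0) ⟩
    gcd 0 0               ≡⟨ gcd[0,0]≡0 ⟩
    0                     ≡⟨ cong (λ g → g * g) g≡0 ⟨
    gcd a b * gcd a b     ∎
    where open ≡-Reasoning
  ... | no  g≢0 = begin
    gcd (a * a) (b * b)                         ≡⟨ cong₂ gcd (split a (gcd[m,n]∣m a b)) (split b (gcd[m,n]∣n a b)) ⟩
    gcd (g * g * (a′ * a′)) (g * g * (b′ * b′)) ≡⟨ c*gcd[m,n]≡gcd[cm,cn] (g * g) _ _ ⟨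
    g * g * gcd (a′ * a′) (b′ * b′)             ≡⟨ cong (g * g *_) (coprime⇒gcd≡1 (coprime-square (coprime-/gcd a b))) ⟩
    g * g * 1                                   ≡⟨ *-identityʳ (g * g) ⟩
    g * g                                       ∎
    where
    open ≡-Reasoning
    g a′ b′ : ℕ
    g  = gcd a b
    instance
      g-nonZero : NonZero g
      g-nonZero = ≢-nonZero g≢0
    a′ = a / g
    b′ = b / g
    split : ∀ x → g ∣ x → x * x ≡ g * g * (x / g * (x / g))
    split x g∣x = begin
      x * x                         ≡⟨ cong (λ y → y * y) (m/n*n≡m g∣x) ⟨
      x / g * g * (x / g * g)       ≡⟨ square-* (x / g) g ⟩
      x / g * (x / g) * (g * g)     ≡⟨ *-comm _ (g * g) ⟩
      g * g * (x / g * (x / g))     ∎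

  square-∣-square⇒∣ : m * m ∣ n * n → m ∣ n
  square-∣-square⇒∣ {m} {n} m²∣n² = subst (_∣ n) gcd≡m (gcd[m,n]∣n m n)
    where
    gcd≡m : gcd m n ≡ m
    gcd≡m = square-injective (trans (sym (gcd-square m n)) (∣-antisym (gcd[m,n]∣m _ _) (gcd-greatest ∣-refl m²∣n²)))

  coprime-factor-of-square : Coprime u v → u * v ≡ w * w → u ≡ gcd u w * gcd u w
  coprime-factor-of-square {u} {v} {w} u⊥v uv≡w² = begin
    u                    ≡⟨ *-identityʳ u ⟨
    u * 1                ≡⟨ cong (u *_) (coprime⇒gcd≡1 u⊥v) ⟨
    u * gcd u v          ≡⟨ c*gcd[m,n]≡gcd[cm,cn] u u v ⟩
    gcd (u * u) (u * v)  ≡⟨ cong (gcd (u * u)) uv≡w² ⟩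
    gcd (u * u) (w * w)  ≡⟨ gcd-square u w ⟩
    gcd u w * gcd u w    ∎
    where open ≡-Reasoning

  coprime-product-square : Coprime u v → u * v ≡ w * w →
                           ∃[ s ] ∃[ t ] (Coprime s t × u ≡ s * s × v ≡ t * t × w ≡ s * t)
  coprime-product-square {u} {v} {w} u⊥v uv≡w² = s , t , s⊥t , u≡s² , v≡t² , w≡st
    where
    open ≡-Reasoning
    s t : ℕ
    s = gcd u w
    t = gcd v w
    u≡s² : u ≡ s * s
    u≡s² = coprime-factor-of-square u⊥v uv≡w²
    v≡t² : v ≡ t * t
    v≡t² = coprime-factor-of-square (coprime-sym u⊥v) (trans (*-comm v u) uv≡w²)
    w≡st : w ≡ s * t
    w≡st = square-injective (begin
      w * w              ≡⟨ uv≡w² ⟨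
      u * v              ≡⟨ cong₂ _*_ u≡s² v≡t² ⟩
      s * s * (t * t)    ≡⟨ square-* s t ⟨
      s * t * (s * t)    ∎)
    s⊥t : Coprime s t
    s⊥t {d} (d∣s , d∣t) = u⊥v (subst (d ∣_) (sym u≡s²) (∣m⇒∣m*n s d∣s) , subst (d ∣_) (sym v≡t²) (∣m⇒∣m*n t d∣t))

  -- Euclid's parametrisation a = m² − n², b = 2mn, c = m² + n², with the subtraction moved to the left.
  EuclidTriple : ℕ → ℕ → ℕ → Set
  EuclidTriple a b c = ∃[ m ] ∃[ n ] (Coprime m n × a + n * n ≡ m * m × b ≡ 2 * (m * n) × c ≡ m * m + n * n)

  odd+even : IsOdd m → IsEven n → IsOdd (m + n)
  odd+even (i , refl) (j , refl) = i + j , cong suc (sym (*-distribˡ-+ 2 i j))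

  odd-gap : IsOdd a → IsOdd c → a ≤ c → ∃[ k ] c ≡ a + 2 * k
  odd-gap (i , refl) (j , refl) a≤c = j ∸ i , cong suc (begin
    2 * j              ≡⟨ cong (2 *_) (m+[n∸m]≡n i≤j) ⟨
    2 * (i + (j ∸ i))  ≡⟨ *-distribˡ-+ 2 i (j ∸ i) ⟩
    2 * i + 2 * (j ∸ i) ∎)
    where
    open ≡-Reasoning
    i≤j : i ≤ j
    i≤j = *-cancelˡ-≤ 2 (s≤s⁻¹ a≤c)

  -- With b = 2B and c = a + 2k the relation a² + b² = c² reads B² = k (k + a), a product of coprime factors.
  euclid-from-gap : ∀ {a B k} → Coprime a (2 * B) → a * a + 2 * B * (2 * B) ≡ (a + 2 * k) * (a + 2 * k) →
                    EuclidTriple a (2 * B) (a + 2 * k)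
  euclid-from-gap {a} {B} {k} a⊥2B pyth with coprime-product-square {w = B} M⊥k (trans (*-comm M k) kM≡B²)
    where
    M : ℕ
    M = k + a
    square-gap : ∀ a k → (a + 2 * k) * (a + 2 * k) ≡ a * a + 4 * (k * (k + a))
    square-gap = solve-∀
    double-square : ∀ B → 2 * B * (2 * B) ≡ 4 * (B * B)
    double-square = solve-∀
    kM≡B² : k * M ≡ B * B
    kM≡B² = sym (*-cancelˡ-≡ _ _ 4 (+-cancelˡ-≡ (a * a) _ _
      (trans (cong (a * a +_) (sym (double-square B))) (trans pyth (square-gap a k)))))
    a⊥B² : Coprime a (B * B)
    a⊥B² = coprime-* a⊥B a⊥B
      where
      a⊥B : Coprime a B
      a⊥B (d∣a , d∣B) = a⊥2B (d∣a , ∣n⇒∣m*n 2 d∣B)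
    M⊥k : Coprime M k
    M⊥k {d} (d∣M , d∣k) = a⊥B² (∣m+n∣m⇒∣n d∣M d∣k , subst (d ∣_) kM≡B² (∣n⇒∣m*n k d∣M))
  ... | m , n , m⊥n , M≡m² , k≡n² , B≡mn = m , n , m⊥n , a+n²≡m² , cong (2 *_) B≡mn , c≡m²+n²
    where
    a+n²≡m² : a + n * n ≡ m * m
    a+n²≡m² = trans (cong (a +_) (sym k≡n²)) (trans (+-comm a k) M≡m²)
    gap-split : ∀ a k → a + 2 * k ≡ k + a + k
    gap-split = solve-∀
    c≡m²+n² : a + 2 * k ≡ m * m + n * n
    c≡m²+n² = trans (gap-split a k) (cong₂ _+_ M≡m² k≡n²)

  primitive-pythagorean : Coprime a b → IsOdd a → a * a + b * b ≡ c * c → EuclidTriple a b c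
  primitive-pythagorean {a} {b} {c} a⊥b odd-a pyth with even⊎odd b
  ... | inj₂ odd-b = ⊥-elim (odd-square-sum≢square {c = c} odd-a odd-b pyth)
  ... | inj₁ (B , refl) with odd-gap odd-a odd-c a≤c
    where
    odd-c : IsOdd c
    odd-c = odd-square⇒odd (subst IsOdd pyth (odd+even (odd-square odd-a) (even-square (B , refl))))
    a≤c : a ≤ c
    a≤c = square-cancel-≤ (subst (a * a ≤_) pyth (m≤m+n (a * a) _))
  ...   | k , refl = euclid-from-gap {a} {B} {k} a⊥b pyth

  m*n>0⇒m>0 : ∀ m n → 0 < m * n → 0 < m
  m*n>0⇒m>0 (suc m) n _ = z<s

  m*n>0⇒n>0 : ∀ m n → 0 < m * n → 0 < n
  m*n>0⇒n>0 m n mn>0 = m*n>0⇒m>0 n m (subst (0 <_) (*-comm m n) mn>0)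

  n≤n*n : ∀ n → n ≤ n * n
  n≤n*n zero    = z≤n
  n≤n*n (suc n) = m≤m*n (suc n) (suc n)

  ^-cancelʳ-≡ : ∀ n .{{_ : NonZero n}} → m ^ n ≡ o ^ n → m ≡ o
  ^-cancelʳ-≡ {m} {o} n eq with <-cmp m o
  ... | tri< m<o _ _ = ⊥-elim (<-irrefl eq (^-monoˡ-< n m<o))
  ... | tri≈ _ m≡o _ = m≡o
  ... | tri> _ _ m>o = ⊥-elim (<-irrefl (sym eq) (^-monoˡ-< n m>o))

  ^-sum-< : ∀ {x y} n → 1 < n → 0 < x → 0 < y → x ^ n + y ^ n < (x + y) ^ n
  ^-sum-< {x} {y} (suc n) (s≤s n>0) x>0 y>0 = begin-strict
    x * x ^ n + y * y ^ n               <⟨ +-mono-≤-< (*-monoʳ-≤ x (^-monoˡ-≤ n (m≤m+n x y)))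
                                                      (*-monoʳ-< y (^-monoˡ-< n (m<n+m y x>0))) ⟩
    x * (x + y) ^ n + y * (x + y) ^ n   ≡⟨ *-distribʳ-+ ((x + y) ^ n) x y ⟨
    (x + y) * (x + y) ^ n               ∎
    where
    open ≤-Reasoning
    instance
      n-nonZero : NonZero n
      n-nonZero = >-nonZero n>0
      y-nonZero : NonZero y
      y-nonZero = >-nonZero y>0

  odd⇒≡1⊎>2 : IsOdd n → n ≡ 1 ⊎ 2 < n
  odd⇒≡1⊎>2 (zero  , refl) = inj₁ refl
  odd⇒≡1⊎>2 (suc k , refl) = inj₂ (s≤s (*-monoʳ-≤ 2 (s≤s z≤n)))

  coprime-leg : Coprime m n → a * a + n * n ≡ m * m → Coprime a n
  coprime-leg {m} {n} {a} m⊥n a²+n²≡m² {d} (d∣a , d∣n) =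
    n⊥m² (d∣n , subst (d ∣_) a²+n²≡m² (∣m∣n⇒∣m+n (∣m⇒∣m*n a d∣a) (∣m⇒∣m*n n d∣n)))
    where
    n⊥m² : Coprime n (m * m)
    n⊥m² = coprime-* (coprime-sym m⊥n) (coprime-sym m⊥n)

  descent-decreases : 0 < n → m ≡ w * w → c ≡ m * m + n * n → w < c
  descent-decreases {n} {m} {w} {c} n>0 m≡w² c≡m²+n² = begin-strict
    w             ≤⟨ n≤n*n w ⟩
    w * w         ≡⟨ m≡w² ⟨
    m             ≤⟨ n≤n*n m ⟩
    m * m         <⟨ m<m+n (m * m) (*-mono-< n>0 n>0) ⟩
    m * m + n * n ≡⟨ c≡m²+n² ⟨
    c             ∎
    where open ≤-Reasoning

  QuarticSolution : ℕ → Set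
  QuarticSolution z = ∃[ x ] ∃[ y ] (0 < x × 0 < y × x * x * (x * x) + y * y * (y * y) ≡ z * z)

  -- Two applications of Euclid's parametrisation give x² = m² − n², y² = 2mn, z = m² + n², then
  -- x = r² − s², n = 2rs, m = r² + s²; so (y/2)² = m r s with m, r, s pairwise coprime, all three are
  -- squares w², u², v², and u⁴ + v⁴ = r² + s² = m = w² with w ≤ m < z.
  primitive-descent : ∀ {x y z} → Coprime x y → IsOdd x → 0 < y → x * x * (x * x) + y * y * (y * y) ≡ z * z →
                      ∃[ w ] (w < z × QuarticSolution w)
  primitive-descent {x} {y} {z} x⊥y odd-x y>0 eq
    with primitive-pythagorean {c = z} (coprime-square x⊥y) (odd-square odd-x) eq
  ... | m , n , m⊥n , x²+n²≡m² , y²≡2mn , z≡m²+n²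
    with primitive-pythagorean {c = m} (coprime-leg m⊥n x²+n²≡m²) odd-x x²+n²≡m²
  ... | r , s , r⊥s , _ , n≡2rs , m≡r²+s²
    with even-square⇒even {y} (m * n , y²≡2mn)
  ... | Y , refl
    with coprime-product-square {w = Y} m⊥rs (sym Y²≡m[rs])
    where
    m⊥rs : Coprime m (r * s)
    m⊥rs {d} (d∣m , d∣rs) = m⊥n (d∣m , subst (d ∣_) (sym n≡2rs) (∣n⇒∣m*n 2 d∣rs))
    half-square : ∀ Y m r s → 2 * Y * (2 * Y) ≡ 2 * (m * (2 * (r * s))) → Y * Y ≡ m * (r * s)
    half-square Y m r s eq = *-cancelˡ-≡ _ _ 4 (trans (lhs Y) (trans eq (rhs m r s)))
      where
      lhs : ∀ Y → 4 * (Y * Y) ≡ 2 * Y * (2 * Y)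
      lhs = solve-∀
      rhs : ∀ m r s → 2 * (m * (2 * (r * s))) ≡ 4 * (m * (r * s))
      rhs = solve-∀
    Y²≡m[rs] : Y * Y ≡ m * (r * s)
    Y²≡m[rs] = half-square Y m r s (trans y²≡2mn (cong (λ n → 2 * (m * n)) n≡2rs))
  ... | w , t , _ , m≡w² , rs≡t² , _
    with coprime-product-square {w = t} r⊥s rs≡t²
  ... | u , v , _ , r≡u² , s≡v² , _ = w , descent-decreases n>0 m≡w² z≡m²+n² , u , v , u>0 , v>0 , u⁴+v⁴≡w²
    where
    n>0 : 0 < n
    n>0 = m*n>0⇒n>0 m n (m*n>0⇒n>0 2 (m * n) (subst (0 <_) y²≡2mn (*-mono-< y>0 y>0)))
    rs>0 : 0 < r * s
    rs>0 = m*n>0⇒n>0 2 (r * s) (subst (0 <_) n≡2rs n>0)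
    u>0 : 0 < u
    u>0 = m*n>0⇒m>0 u u (subst (0 <_) r≡u² (m*n>0⇒m>0 r s rs>0))
    v>0 : 0 < v
    v>0 = m*n>0⇒m>0 v v (subst (0 <_) s≡v² (m*n>0⇒n>0 r s rs>0))
    u⁴+v⁴≡w² : u * u * (u * u) + v * v * (v * v) ≡ w * w
    u⁴+v⁴≡w² = begin
      u * u * (u * u) + v * v * (v * v) ≡⟨ cong₂ (λ r s → r * r + s * s) r≡u² s≡v² ⟨
      r * r + s * s                     ≡⟨ m≡r²+s² ⟨
      m                                 ≡⟨ m≡w² ⟩
      w * w                             ∎
      where open ≡-Reasoning

  quartic-scale-down : ∀ {g x y z} → 1 < g → 0 < x → 0 < y →
                       x * g * (x * g) * (x * g * (x * g)) + y * g * (y * g) * (y * g * (y * g)) ≡ z * z →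
                       ∃[ z′ ] (z′ < z × QuarticSolution z′)
  quartic-scale-down {g} {x} {y} {z} g>1 x>0 y>0 eq = z′ , z′<z , x , y , x>0 , y>0 , x⁴+y⁴≡z′²
    where
    instance
      g-nonZero : NonZero g
      g-nonZero = >-nonZero (<-trans z<s g>1)
      g²-nonZero : NonZero (g * g)
      g²-nonZero = m*n≢0 g g
      g⁴-nonZero : NonZero (g * g * (g * g))
      g⁴-nonZero = m*n≢0 (g * g) (g * g)
    factor-g⁴ : ∀ x y g → x * g * (x * g) * (x * g * (x * g)) + y * g * (y * g) * (y * g * (y * g))
                          ≡ g * g * (g * g) * (x * x * (x * x) + y * y * (y * y))
    factor-g⁴ = solve-∀
    g⁴∣z² : g * g * (g * g) ∣ z * z
    g⁴∣z² = divides (x * x * (x * x) + y * y * (y * y)) (trans (sym eq) (trans (factor-g⁴ x y g) (*-comm (g * g * (g * g)) _)))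
    z′ : ℕ
    z′ = z / (g * g)
    z≡z′g² : z ≡ z′ * (g * g)
    z≡z′g² = sym (m/n*n≡m (square-∣-square⇒∣ g⁴∣z²))
    x⁴+y⁴≡z′² : x * x * (x * x) + y * y * (y * y) ≡ z′ * z′
    x⁴+y⁴≡z′² = *-cancelˡ-≡ _ _ (g * g * (g * g)) (begin
      g * g * (g * g) * (x * x * (x * x) + y * y * (y * y)) ≡⟨ factor-g⁴ x y g ⟨
      _                                                   ≡⟨ eq ⟩
      z * z                                               ≡⟨ cong (λ z → z * z) z≡z′g² ⟩
      z′ * (g * g) * (z′ * (g * g))                          ≡⟨ square-* z′ (g * g) ⟩
      z′ * z′ * (g * g * (g * g))                            ≡⟨ *-comm (z′ * z′) _ ⟩
      g * g * (g * g) * (z′ * z′)                            ∎)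
      where open ≡-Reasoning
    z′>0 : 0 < z′
    z′>0 = m*n>0⇒m>0 z′ z′ (subst (0 <_) x⁴+y⁴≡z′² (<-≤-trans (*-mono-< (*-mono-< x>0 x>0) (*-mono-< x>0 x>0)) (m≤m+n _ _)))
    z′<z : z′ < z
    z′<z = subst (z′ <_) (sym z≡z′g²) (m<m*n z′ (g * g) (*-mono-< g>1 g>1))
      where
      instance
        z′-nonZero : NonZero z′
        z′-nonZero = >-nonZero z′>0

  coprime-quartic-descent : ∀ {x y z} → Coprime x y → 0 < x → 0 < y → x * x * (x * x) + y * y * (y * y) ≡ z * z →
                            ∃[ w ] (w < z × QuarticSolution w)
  coprime-quartic-descent {x} {y} x⊥y x>0 y>0 eq with even⊎odd x | even⊎odd y
  ... | inj₂ odd-x | _         = primitive-descent x⊥y odd-x y>0 eq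
  ... | inj₁ _     | inj₂ odd-y = primitive-descent (coprime-sym x⊥y) odd-y x>0 (trans (+-comm (y * y * (y * y)) _) eq)
  ... | inj₁ (i , refl) | inj₁ (j , refl) with x⊥y (divides i (*-comm 2 i) , divides j (*-comm 2 j))
  ... | ()

  quartic-descent : ∀ {z} → QuarticSolution z → ∃[ w ] (w < z × QuarticSolution w)
  quartic-descent (x , y , x>0 , y>0 , eq) with gcd x y ≟ 1
  ... | yes g≡1 = coprime-quartic-descent (gcd≡1⇒coprime g≡1) x>0 y>0 eq
  ... | no  g≢1 = quartic-scale-down g>1 (m*n>0⇒m>0 x′ g (subst (0 <_) x≡x′g x>0))
                    (m*n>0⇒m>0 y′ g (subst (0 <_) y≡y′g y>0))
                    (subst₂ (λ x y → x * x * (x * x) + y * y * (y * y) ≡ _) x≡x′g y≡y′g eq)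
    where
    g x′ y′ : ℕ
    g = gcd x y
    g>1 : 1 < g
    g>1 = ≤∧≢⇒< (n≢0⇒n>0 (gcd[m,n]≢0 x y (inj₁ (n>0⇒n≢0 x>0)))) (g≢1 ∘ sym)
    instance
      g-nonZero : NonZero g
      g-nonZero = >-nonZero (<-trans z<s g>1)
    x′ = x / g
    y′ = y / g
    x≡x′g : x ≡ x′ * g
    x≡x′g = sym (m/n*n≡m (gcd[m,n]∣m x y))
    y≡y′g : y ≡ y′ * g
    y≡y′g = sym (m/n*n≡m (gcd[m,n]∣n x y))

  no-quartic-solution : ∀ z → ¬ QuarticSolution z
  no-quartic-solution = <-rec (λ z → ¬ QuarticSolution z) λ z smaller sol →
    let w , w<z , sol′ = quartic-descent sol in smaller w<z sol′

  FermatSolution : ℕ → Set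
  FermatSolution n = ∃[ X ] ∃[ Y ] ∃[ Z ] (1 ≤ X × 1 ≤ Y × 1 ≤ Z × X ^ n + Y ^ n ≡ Z ^ n)

  no-fermat-4 : ¬ FermatSolution 4
  no-fermat-4 (X , Y , Z , X>0 , Y>0 , _ , eq) =
    no-quartic-solution (Z * Z) (X , Y , X>0 , Y>0 , trans (sym (cong₂ _+_ (^4 X) (^4 Y))) (trans eq (^4 Z)))
    where
    ^4 : ∀ x → x ^ 4 ≡ x * x * (x * x)
    ^4 x = trans (cong (λ y → x * (x * (x * y))) (*-identityʳ x)) (sym (*-assoc x x (x * x)))

  fermat-solution-divisor : ∀ d n → FermatSolution (d * n) → FermatSolution n
  fermat-solution-divisor d n (X , Y , Z , X>0 , Y>0 , Z>0 , eq) =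
    X ^ d , Y ^ d , Z ^ d , ^-positive X>0 , ^-positive Y>0 , ^-positive Z>0 ,
    trans (cong₂ _+_ (^-*-assoc X d n) (^-*-assoc Y d n)) (trans eq (sym (^-*-assoc Z d n)))
    where
    ^-positive : ∀ {X} → 0 < X → 0 < X ^ d
    ^-positive {X} X>0 = m^n>0 X {{>-nonZero X>0}} d

  odd-exponent-solution : ∀ {m} → 2 < m → FermatSolution m → ∃[ n ] (IsOdd n × 2 < n × FermatSolution n)
  odd-exponent-solution {m} m>2 sol with even⊎odd m
  ... | inj₂ odd-m = m , odd-m , m>2 , sol
  ... | inj₁ (h , refl) with even⊎odd h
  ...   | inj₁ (k , refl) = ⊥-elim (no-fermat-4 (fermat-solution-divisor k 4 (subst FermatSolution (4k≡k*4 k) sol)))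
    where
    4k≡k*4 : ∀ k → 2 * (2 * k) ≡ k * 4
    4k≡k*4 = solve-∀
  ...   | inj₂ odd-h with odd⇒≡1⊎>2 odd-h
  ...     | inj₁ refl = ⊥-elim (<-irrefl refl m>2)
  ...     | inj₂ h>2  = h , odd-h , h>2 , fermat-solution-divisor 2 h sol

module IntegerSolutions where

  open import Data.Nat as ℕ using (ℕ; zero; suc; s≤s)
  import Data.Nat.Properties as ℕ
  open import Data.Integer using (ℤ; +_; -[1+_]; -_; _+_; _*_; _^_; 0ℤ; 1ℤ; sign; ∣_∣; _◃_)
  open import Data.Integer.Properties
  open import Data.Integer.Tactic.RingSolver using (solve-∀)
  import Data.Sign as Sign
  open import Data.Product using (∃-syntax; _×_; _,_)
  open import Data.Sum using (_⊎_; inj₁; inj₂)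
  open import Data.Empty using (⊥-elim)
  open import Function using (_∘_)
  open import Relation.Binary.PropositionalEquality
  open Fermat using (FermatSolution; ^-sum-<)

  private variable
    n : ℕ
    i j : ℤ

  pos-^ : ∀ m n → (+ m) ^ n ≡ + (m ℕ.^ n)
  pos-^ m zero    = refl
  pos-^ m (suc n) = trans (cong (+ m *_) (pos-^ m n)) (sym (pos-* m (m ℕ.^ n)))

  ^-odd-neg : IsOdd n → ∀ i → (- i) ^ n ≡ - (i ^ n)
  ^-odd-neg (k , refl) i = begin
    (- i) * (- i) ^ (2 ℕ.* k)       ≡⟨ cong ((- i) *_) (^-*-assoc (- i) 2 k) ⟨
    (- i) * ((- i) ^ 2) ^ k         ≡⟨ cong (λ j → (- i) * j ^ k) (square-neg i) ⟩
    (- i) * (i ^ 2) ^ k             ≡⟨ neg-distribˡ-* i _ ⟨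
    - (i * (i ^ 2) ^ k)             ≡⟨ cong (λ j → - (i * j)) (^-*-assoc i 2 k) ⟩
    - (i * i ^ (2 ℕ.* k))           ∎
    where
    open ≡-Reasoning
    square-neg : ∀ i → (- i) * ((- i) * 1ℤ) ≡ i * (i * 1ℤ)
    square-neg = solve-∀

  negsuc-^ : IsOdd n → ∀ m → -[1+ m ] ^ n ≡ - (+ (suc m ℕ.^ n))
  negsuc-^ {n} odd m = trans (^-odd-neg odd (+ suc m)) (cong -_ (pos-^ (suc m) n))

  ^-odd-◃ : IsOdd n → ∀ i → i ^ n ≡ sign i ◃ (∣ i ∣ ℕ.^ n)
  ^-odd-◃ {n} _   (+ m)    = trans (pos-^ m n) (sym (+◃n≡+n (m ℕ.^ n)))
  ^-odd-◃ {n} odd -[1+ m ] = trans (negsuc-^ odd m) (sym (-◃n≡-n (suc m ℕ.^ n)))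

  +≢-+ : ∀ m {n} → 0 ℕ.< n → + m ≢ - (+ n)
  +≢-+ m {suc n} _ ()

  ^-odd-injective : IsOdd n → i ^ n ≡ j ^ n → i ≡ j
  ^-odd-injective {n} {+ a} {+ b} (_ , refl) eq =
    cong +_ (Fermat.^-cancelʳ-≡ n (+-injective (trans (sym (pos-^ a n)) (trans eq (pos-^ b n)))))
  ^-odd-injective {n} { -[1+ a ]} { -[1+ b ]} odd@(_ , refl) eq =
    cong -[1+_] (ℕ.suc-injective (Fermat.^-cancelʳ-≡ n
      (+-injective (neg-injective (trans (sym (negsuc-^ odd a)) (trans eq (negsuc-^ odd b)))))))
  ^-odd-injective {n} {+ a} { -[1+ b ]} odd@(_ , refl) eq =
    ⊥-elim (+≢-+ (a ℕ.^ n) (ℕ.m^n>0 (suc b) n) (trans (sym (pos-^ a n)) (trans eq (negsuc-^ odd b))))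
  ^-odd-injective {n} { -[1+ a ]} {+ b} odd@(_ , refl) eq =
    ⊥-elim (+≢-+ (b ℕ.^ n) (ℕ.m^n>0 (suc a) n) (trans (sym (pos-^ b n)) (trans (sym eq) (negsuc-^ odd a))))

  +≡0⇒≡- : i + j ≡ 0ℤ → i ≡ - j
  +≡0⇒≡- {i} {j} eq = i-j≡0⇒i≡j i (- j) (trans (cong (λ k → i + k) (neg-involutive j)) eq)

  ^-odd-sum≡0 : IsOdd n → i ^ n + j ^ n ≡ 0ℤ → i + j ≡ 0ℤ
  ^-odd-sum≡0 {n} {i} {j} odd eq = trans (cong (_+ j) i≡-j) (+-inverseˡ j)
    where
    i≡-j : i ≡ - j
    i≡-j = ^-odd-injective odd (trans (+≡0⇒≡- eq) (sym (^-odd-neg odd j)))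

  balance : ∀ {P Q} → + P + - (+ Q) ≡ 0ℤ → P ≡ Q
  balance eq = +-injective (i-j≡0⇒i≡j _ _ eq)

  ◃-sum≡0 : ∀ σ τ υ {A B C} → 0 ℕ.< A → 0 ℕ.< B → 0 ℕ.< C → (σ ◃ A) + (τ ◃ B) + (υ ◃ C) ≡ 0ℤ →
            A ℕ.+ B ≡ C ⊎ A ℕ.+ C ≡ B ⊎ B ℕ.+ C ≡ A
  ◃-sum≡0 Sign.+ Sign.+ Sign.+ (s≤s _) (s≤s _) (s≤s _) ()
  ◃-sum≡0 Sign.- Sign.- Sign.- (s≤s _) (s≤s _) (s≤s _) ()
  ◃-sum≡0 Sign.+ Sign.+ Sign.- (s≤s _) (s≤s _) (s≤s _) eq = inj₁ (balance eq)
  ◃-sum≡0 Sign.+ Sign.- Sign.+ {A} {B} {C} (s≤s _) (s≤s _) (s≤s _) eq =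
    inj₂ (inj₁ (balance (trans (swap (+ A) (+ B) (+ C)) eq)))
    where
    swap : ∀ x y z → x + z + - y ≡ x + - y + z
    swap = solve-∀
  ◃-sum≡0 Sign.- Sign.+ Sign.+ {A} {B} {C} (s≤s _) (s≤s _) (s≤s _) eq =
    inj₂ (inj₂ (balance (trans (swap (+ A) (+ B) (+ C)) eq)))
    where
    swap : ∀ x y z → y + z + - x ≡ - x + y + z
    swap = solve-∀
  ◃-sum≡0 Sign.- Sign.- Sign.+ {A} {B} {C} (s≤s _) (s≤s _) (s≤s _) eq =
    inj₁ (balance (trans (negate (+ A) (+ B) (+ C)) (cong -_ eq)))
    where
    negate : ∀ x y z → x + y + - z ≡ - (- x + - y + z)
    negate = solve-∀
  ◃-sum≡0 Sign.- Sign.+ Sign.- {A} {B} {C} (s≤s _) (s≤s _) (s≤s _) eq =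
    inj₂ (inj₁ (balance (trans (negate (+ A) (+ B) (+ C)) (cong -_ eq))))
    where
    negate : ∀ x y z → x + z + - y ≡ - (- x + y + - z)
    negate = solve-∀
  ◃-sum≡0 Sign.+ Sign.- Sign.- {A} {B} {C} (s≤s _) (s≤s _) (s≤s _) eq =
    inj₂ (inj₂ (balance (trans (negate (+ A) (+ B) (+ C)) (cong -_ eq))))
    where
    negate : ∀ x y z → y + z + - x ≡ - (x + - y + - z)
    negate = solve-∀

  IntegralSolution : ℕ → Set
  IntegralSolution n = ∃[ u ] ∃[ v ] ∃[ w ] (u ^ n + v ^ n + w ^ n ≡ 0ℤ × w ≢ 0ℤ × u + v + w ≢ 0ℤ)

  ^-odd-sum≡0⇒≢0 : ∀ {k} → IsOdd n → i ^ n + j ^ n + k ^ n ≡ 0ℤ → k ≢ 0ℤ → i + j ≢ 0ℤ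
  ^-odd-sum≡0⇒≢0 {n} {i} {j} {k} odd eq k≢0 i+j≡0 = k≢0 (i^n≡0⇒i≡0 k n k^n≡0)
    where
    i^n+j^n≡0 : i ^ n + j ^ n ≡ 0ℤ
    i^n+j^n≡0 = begin
      i ^ n + j ^ n         ≡⟨ cong (λ i → i ^ n + j ^ n) (+≡0⇒≡- i+j≡0) ⟩
      (- j) ^ n + j ^ n     ≡⟨ cong (_+ j ^ n) (^-odd-neg odd j) ⟩
      - (j ^ n) + j ^ n     ≡⟨ +-inverseˡ (j ^ n) ⟩
      0ℤ                    ∎
      where open ≡-Reasoning
    k^n≡0 : k ^ n ≡ 0ℤ
    k^n≡0 = trans (sym (+-identityˡ (k ^ n))) (trans (cong (_+ k ^ n) (sym i^n+j^n≡0)) eq)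

  ∣∣-positive : i ≢ 0ℤ → 0 ℕ.< ∣ i ∣
  ∣∣-positive i≢0 = ℕ.n≢0⇒n>0 (i≢0 ∘ ∣i∣≡0⇒i≡0)

  fermat-of-nonzero : ∀ {u v w} → IsOdd n → u ≢ 0ℤ → v ≢ 0ℤ → w ≢ 0ℤ → u ^ n + v ^ n + w ^ n ≡ 0ℤ →
                      FermatSolution n
  fermat-of-nonzero {n} {u} {v} {w} odd u≢0 v≢0 w≢0 eq
    with ◃-sum≡0 (sign u) (sign v) (sign w) (∣∣^n-positive u≢0) (∣∣^n-positive v≢0) (∣∣^n-positive w≢0) eq◃
    where
    ∣∣^n-positive : ∀ {i} → i ≢ 0ℤ → 0 ℕ.< ∣ i ∣ ℕ.^ n
    ∣∣^n-positive {i} i≢0 = ℕ.m^n>0 ∣ i ∣ {{ℕ.>-nonZero (∣∣-positive i≢0)}} n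
    eq◃ : (sign u ◃ ∣ u ∣ ℕ.^ n) + (sign v ◃ ∣ v ∣ ℕ.^ n) + (sign w ◃ ∣ w ∣ ℕ.^ n) ≡ 0ℤ
    eq◃ = trans (sym (cong₂ _+_ (cong₂ _+_ (^-odd-◃ odd u) (^-odd-◃ odd v)) (^-odd-◃ odd w))) eq
  ... | inj₁ e         = ∣ u ∣ , ∣ v ∣ , ∣ w ∣ , ∣∣-positive u≢0 , ∣∣-positive v≢0 , ∣∣-positive w≢0 , e
  ... | inj₂ (inj₁ e)  = ∣ u ∣ , ∣ w ∣ , ∣ v ∣ , ∣∣-positive u≢0 , ∣∣-positive w≢0 , ∣∣-positive v≢0 , e
  ... | inj₂ (inj₂ e)  = ∣ v ∣ , ∣ w ∣ , ∣ u ∣ , ∣∣-positive v≢0 , ∣∣-positive w≢0 , ∣∣-positive u≢0 , e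

  integral⇒fermat : IsOdd n → IntegralSolution n → 2 ℕ.< n × FermatSolution n
  integral⇒fermat {n} odd (u , v , w , eq , w≢0 , sum≢0) with Fermat.odd⇒≡1⊎>2 odd
  ... | inj₁ refl = ⊥-elim (sum≢0 (trans (cong₂ _+_ (cong₂ _+_ (^1 u) (^1 v)) (^1 w)) eq))
    where
    ^1 : ∀ i → i ≡ i ^ 1
    ^1 i = sym (^-identityʳ i)
  ... | inj₂ n>2@(s≤s _) = n>2 , fermat-of-nonzero odd u≢0 v≢0 w≢0 eq
    where
    u≢0 : u ≢ 0ℤ
    u≢0 refl = sum≢0 (trans (cong (_+ w) (+-identityˡ v))
                            (^-odd-sum≡0 {i = v} {j = w} odd (trans (cong (_+ w ^ n) (sym (+-identityˡ (v ^ n)))) eq)))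
    v≢0 : v ≢ 0ℤ
    v≢0 refl = sum≢0 (trans (cong (_+ w) (+-identityʳ u))
                            (^-odd-sum≡0 {i = u} {j = w} odd (trans (cong (_+ w ^ n) (sym (+-identityʳ (u ^ n)))) eq)))

  fermat⇒integral : IsOdd n → 1 ℕ.< n → FermatSolution n → IntegralSolution n
  fermat⇒integral {n} odd n>1 (X , Y , Z , X>0 , Y>0 , Z>0 , eq) = + X , + Y , - (+ Z) , eqℤ , w≢0 , sum≢0
    where
    eqℤ : (+ X) ^ n + (+ Y) ^ n + (- (+ Z)) ^ n ≡ 0ℤ
    eqℤ = begin
      (+ X) ^ n + (+ Y) ^ n + (- (+ Z)) ^ n      ≡⟨ cong₂ _+_ (cong₂ _+_ (pos-^ X n) (pos-^ Y n))
                                                               (trans (^-odd-neg odd (+ Z)) (cong -_ (pos-^ Z n))) ⟩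
      + (X ℕ.^ n ℕ.+ Y ℕ.^ n) + - (+ (Z ℕ.^ n))  ≡⟨ cong (λ m → + m + - (+ (Z ℕ.^ n))) eq ⟩
      + (Z ℕ.^ n) + - (+ (Z ℕ.^ n))              ≡⟨ +-inverseʳ (+ (Z ℕ.^ n)) ⟩
      0ℤ                                        ∎
      where open ≡-Reasoning
    w≢0 : - (+ Z) ≢ 0ℤ
    w≢0 e = ℕ.<-irrefl (sym (+-injective (neg-injective {+ Z} {0ℤ} e))) Z>0
    sum≢0 : + X + + Y + - (+ Z) ≢ 0ℤ
    sum≢0 e = ℕ.<-irrefl (trans eq (cong (ℕ._^ n) (sym (balance e)))) (^-sum-< n n>1 X>0 Y>0)

module RationalRoots where

  open import Data.Nat as ℕ using (ℕ; zero; suc)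
  import Data.Nat.Properties as ℕ
  open import Data.Integer as ℤ using (ℤ; -[1+_])
  import Data.Integer.Properties as ℤ
  open import Data.Integer.Tactic.RingSolver as ℤ-Solver using ()
  open import Data.Rational using (ℚ; mkℚ; 0ℚ; 1ℚ; -_; _+_; _*_; _-_; 1/_; ↥_; ↧_; NonZero; ≢-nonZero)
  open import Data.Rational.Literals using (fromℤ)
  open import Data.Rational.Properties
  import Data.Rational.Unnormalised as ℚᵘ
  import Data.Rational.Unnormalised.Properties as ℚᵘ
  open import Data.Product using (∃-syntax; _×_; _,_)
  open import Function using (_∘_)
  open import Function.Bundles using (_⇔_; mk⇔; Equivalence)
  open import Level using (0ℓ)
  open import Relation.Nullary.Decidable using (dec⇒maybe)
  open import Relation.Binary.PropositionalEquality
  open import Tactic.RingSolver using (solve-∀)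
  open import Tactic.RingSolver.Core.AlmostCommutativeRing using (AlmostCommutativeRing; fromCommutativeRing)
  open IntegerSolutions using (IntegralSolution; ^-odd-sum≡0⇒≢0)

  private variable
    n : ℕ
    i j : ℤ
    p q : ℚ

  ℚ-ring : AlmostCommutativeRing 0ℓ 0ℓ
  ℚ-ring = fromCommutativeRing +-*-commutativeRing (λ p → dec⇒maybe (0ℚ ≟ p))

  fromℤ-injective : fromℤ i ≡ fromℤ j → i ≡ j
  fromℤ-injective = cong ↥_

  fromℤ-+ : ∀ i j → fromℤ (i ℤ.+ j) ≡ fromℤ i + fromℤ j
  fromℤ-+ i j = toℚᵘ-injective (ℚᵘ.≃-trans (ℚᵘ.*≡* (denominators-one i j)) (ℚᵘ.≃-sym (toℚᵘ-homo-+ (fromℤ i) (fromℤ j))))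
    where
    denominators-one : ∀ i j → (i ℤ.+ j) ℤ.* ℤ.+ 1 ≡ (i ℤ.* ℤ.+ 1 ℤ.+ j ℤ.* ℤ.+ 1) ℤ.* ℤ.+ 1
    denominators-one = ℤ-Solver.solve-∀

  fromℤ-* : ∀ i j → fromℤ (i ℤ.* j) ≡ fromℤ i * fromℤ j
  fromℤ-* i j = toℚᵘ-injective (ℚᵘ.≃-sym (toℚᵘ-homo-* (fromℤ i) (fromℤ j)))

  fromℤ-neg : ∀ i → fromℤ (ℤ.- i) ≡ - fromℤ i
  fromℤ-neg (ℤ.+ zero)  = refl
  fromℤ-neg (ℤ.+ suc m) = refl
  fromℤ-neg -[1+ m ]  = refl

  fromℤ-^ : ∀ i n → fromℤ (i ℤ.^ n) ≡ fromℤ i ^ℚ n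
  fromℤ-^ i zero    = refl
  fromℤ-^ i (suc n) = trans (fromℤ-* i (i ℤ.^ n)) (cong (fromℤ i *_) (fromℤ-^ i n))

  *-clear-denominator : ∀ q → q * fromℤ (↧ q) ≡ fromℤ (↥ q)
  *-clear-denominator q@(mkℚ m d _) = toℚᵘ-injective (ℚᵘ.≃-trans (toℚᵘ-homo-* q (fromℤ (↧ q)))
    (ℚᵘ.*≡* (trans (ℤ.*-identityʳ _) (cong (λ e → m ℤ.* ℤ.+ suc e) (sym (ℕ.*-identityʳ d))))))

  *-cancelʳ-≡0 : q ≢ 0ℚ → p * q ≡ 0ℚ → p ≡ 0ℚ
  *-cancelʳ-≡0 {q} {p} q≢0 pq≡0 = begin
    p                ≡⟨ *-identityʳ p ⟨
    p * 1ℚ           ≡⟨ cong (p *_) (*-inverseʳ q) ⟨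
    p * (q * 1/ q)   ≡⟨ *-assoc p q (1/ q) ⟨
    p * q * 1/ q     ≡⟨ cong (_* 1/ q) pq≡0 ⟩
    0ℚ * 1/ q        ≡⟨ *-zeroˡ (1/ q) ⟩
    0ℚ               ∎
    where
    open ≡-Reasoning
    instance
      q-nonZero : NonZero q
      q-nonZero = ≢-nonZero q≢0

  ^ℚ-≢0 : ∀ n → q ≢ 0ℚ → q ^ℚ n ≢ 0ℚ
  ^ℚ-≢0 zero    _   = 1≢0
  ^ℚ-≢0 {q} (suc n) q≢0 = ^ℚ-≢0 n q≢0 ∘ *-cancelʳ-≡0 q≢0 ∘ trans (*-comm (q ^ℚ n) q)

  ^ℚ-distrib-* : ∀ p q n → (p * q) ^ℚ n ≡ p ^ℚ n * q ^ℚ n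
  ^ℚ-distrib-* p q zero    = refl
  ^ℚ-distrib-* p q (suc n) = trans (cong (p * q *_) (^ℚ-distrib-* p q n)) (interchange p q (p ^ℚ n) (q ^ℚ n))
    where
    interchange : ∀ p q r s → p * q * (r * s) ≡ p * r * (q * s)
    interchange = solve-∀ ℚ-ring

  K-scale : ∀ a n x t → K a n x * t ^ℚ n ≡ (x * t) ^ℚ n + ((1ℚ - x) * t) ^ℚ n + (a * t) ^ℚ n
  K-scale a n x t = begin
    (x ^ℚ n + (1ℚ - x) ^ℚ n + a ^ℚ n) * t ^ℚ n                  ≡⟨ distrib (x ^ℚ n) ((1ℚ - x) ^ℚ n) (a ^ℚ n) (t ^ℚ n) ⟩
    x ^ℚ n * t ^ℚ n + (1ℚ - x) ^ℚ n * t ^ℚ n + a ^ℚ n * t ^ℚ n  ≡⟨ cong₂ _+_ (cong₂ _+_ (^ℚ-distrib-* x t n)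
                                                                     (^ℚ-distrib-* (1ℚ - x) t n)) (^ℚ-distrib-* a t n) ⟨
    (x * t) ^ℚ n + ((1ℚ - x) * t) ^ℚ n + (a * t) ^ℚ n          ∎
    where
    open ≡-Reasoning
    distrib : ∀ p q r s → (p + q + r) * s ≡ p * s + q * s + r * s
    distrib = solve-∀ ℚ-ring

  record DenominatorClearing (a x : ℚ) : Set where
    field
      t       : ℚ
      t≢0     : t ≢ 0ℚ
      u v w   : ℤ
      x*t     : x * t ≡ fromℤ u
      [1-x]*t : (1ℚ - x) * t ≡ fromℤ v
      a*t     : a * t ≡ fromℤ w

  module _ {a x : ℚ} (c : DenominatorClearing a x) where
    open DenominatorClearing c

    K-cleared : ∀ n → K a n x * t ^ℚ n ≡ fromℤ (u ℤ.^ n ℤ.+ v ℤ.^ n ℤ.+ w ℤ.^ n)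
    K-cleared n = begin
      K a n x * t ^ℚ n                                    ≡⟨ K-scale a n x t ⟩
      (x * t) ^ℚ n + ((1ℚ - x) * t) ^ℚ n + (a * t) ^ℚ n  ≡⟨ cong₂ _+_ (cong₂ _+_ (cong (_^ℚ n) x*t) (cong (_^ℚ n) [1-x]*t))
                                                                      (cong (_^ℚ n) a*t) ⟩
      fromℤ u ^ℚ n + fromℤ v ^ℚ n + fromℤ w ^ℚ n         ≡⟨ cong₂ _+_ (cong₂ _+_ (fromℤ-^ u n) (fromℤ-^ v n)) (fromℤ-^ w n) ⟨
      fromℤ (u ℤ.^ n) + fromℤ (v ℤ.^ n) + fromℤ (w ℤ.^ n) ≡⟨ cong (_+ fromℤ (w ℤ.^ n)) (fromℤ-+ (u ℤ.^ n) (v ℤ.^ n)) ⟨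
      fromℤ (u ℤ.^ n ℤ.+ v ℤ.^ n) + fromℤ (w ℤ.^ n)       ≡⟨ fromℤ-+ (u ℤ.^ n ℤ.+ v ℤ.^ n) (w ℤ.^ n) ⟨
      fromℤ (u ℤ.^ n ℤ.+ v ℤ.^ n ℤ.+ w ℤ.^ n)             ∎
      where open ≡-Reasoning

    sum-cleared : (1ℚ + a) * t ≡ fromℤ (u ℤ.+ v ℤ.+ w)
    sum-cleared = begin
      (1ℚ + a) * t                        ≡⟨ regroup x a t ⟩
      x * t + (1ℚ - x) * t + a * t        ≡⟨ cong₂ _+_ (cong₂ _+_ x*t [1-x]*t) a*t ⟩
      fromℤ u + fromℤ v + fromℤ w         ≡⟨ cong (_+ fromℤ w) (fromℤ-+ u v) ⟨
      fromℤ (u ℤ.+ v) + fromℤ w           ≡⟨ fromℤ-+ (u ℤ.+ v) w ⟨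
      fromℤ (u ℤ.+ v ℤ.+ w)               ∎
      where
      open ≡-Reasoning
      regroup : ∀ x a t → (1ℚ + a) * t ≡ x * t + (1ℚ - x) * t + a * t
      regroup = solve-∀ ℚ-ring

    K≡0⇔ : ∀ n → K a n x ≡ 0ℚ ⇔ u ℤ.^ n ℤ.+ v ℤ.^ n ℤ.+ w ℤ.^ n ≡ ℤ.0ℤ
    K≡0⇔ n = mk⇔
      (λ root → fromℤ-injective (trans (sym (K-cleared n)) (trans (cong (_* t ^ℚ n) root) (*-zeroˡ (t ^ℚ n)))))
      (λ eq → *-cancelʳ-≡0 (^ℚ-≢0 n t≢0) (trans (K-cleared n) (cong fromℤ eq)))

    a≡0⇔w≡0 : a ≡ 0ℚ ⇔ w ≡ ℤ.0ℤ
    a≡0⇔w≡0 = mk⇔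
      (λ a≡0 → fromℤ-injective (trans (sym a*t) (trans (cong (_* t) a≡0) (*-zeroˡ t))))
      (λ w≡0 → *-cancelʳ-≡0 t≢0 (trans a*t (cong fromℤ w≡0)))

    a≡-1⇔sum≡0 : a ≡ - 1ℚ ⇔ u ℤ.+ v ℤ.+ w ≡ ℤ.0ℤ
    a≡-1⇔sum≡0 = mk⇔
      (λ a≡-1 → fromℤ-injective (trans (sym sum-cleared) (trans (cong (λ a → (1ℚ + a) * t) a≡-1) (*-zeroˡ t))))
      (λ sum≡0 → trans (shift a) (cong (λ b → - 1ℚ + b) (*-cancelʳ-≡0 {p = 1ℚ + a} t≢0 (trans sum-cleared (cong fromℤ sum≡0)))))
      where
      shift : ∀ a → a ≡ - 1ℚ + (1ℚ + a)
      shift = solve-∀ ℚ-ring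

  common-denominator : ∀ a x → DenominatorClearing a x
  common-denominator a x = record
    { t = fromℤ T ; t≢0 = t≢0 ; u = ↥ x ℤ.* ↧ a ; v = T ℤ.- ↥ x ℤ.* ↧ a ; w = ↥ a ℤ.* ↧ x
    ; x*t = x*t ; [1-x]*t = [1-x]*t ; a*t = a*t }
    where
    open ≡-Reasoning
    T : ℤ
    T = ↧ x ℤ.* ↧ a
    t≢0 : fromℤ T ≢ 0ℚ
    t≢0 t≡0 with fromℤ-injective {j = ℤ.0ℤ} t≡0
    ... | ()
    x*t : x * fromℤ T ≡ fromℤ (↥ x ℤ.* ↧ a)
    x*t = begin
      x * fromℤ T                        ≡⟨ cong (x *_) (fromℤ-* (↧ x) (↧ a)) ⟩
      x * (fromℤ (↧ x) * fromℤ (↧ a))    ≡⟨ *-assoc x _ _ ⟨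
      x * fromℤ (↧ x) * fromℤ (↧ a)      ≡⟨ cong (_* fromℤ (↧ a)) (*-clear-denominator x) ⟩
      fromℤ (↥ x) * fromℤ (↧ a)          ≡⟨ fromℤ-* (↥ x) (↧ a) ⟨
      fromℤ (↥ x ℤ.* ↧ a)                ∎
    a*t : a * fromℤ T ≡ fromℤ (↥ a ℤ.* ↧ x)
    a*t = begin
      a * fromℤ T                        ≡⟨ cong (a *_) (fromℤ-* (↧ x) (↧ a)) ⟩
      a * (fromℤ (↧ x) * fromℤ (↧ a))    ≡⟨ rearrange a (fromℤ (↧ x)) (fromℤ (↧ a)) ⟩
      a * fromℤ (↧ a) * fromℤ (↧ x)      ≡⟨ cong (_* fromℤ (↧ x)) (*-clear-denominator a) ⟩
      fromℤ (↥ a) * fromℤ (↧ x)          ≡⟨ fromℤ-* (↥ a) (↧ x) ⟨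
      fromℤ (↥ a ℤ.* ↧ x)                ∎
      where
      rearrange : ∀ a d e → a * (d * e) ≡ a * e * d
      rearrange = solve-∀ ℚ-ring
    [1-x]*t : (1ℚ - x) * fromℤ T ≡ fromℤ (T ℤ.- ↥ x ℤ.* ↧ a)
    [1-x]*t = begin
      (1ℚ - x) * fromℤ T                        ≡⟨ distrib x (fromℤ T) ⟩
      fromℤ T - x * fromℤ T                     ≡⟨ cong (λ p → fromℤ T - p) x*t ⟩
      fromℤ T - fromℤ (↥ x ℤ.* ↧ a)             ≡⟨ cong (fromℤ T +_) (fromℤ-neg (↥ x ℤ.* ↧ a)) ⟨
      fromℤ T + fromℤ (ℤ.- (↥ x ℤ.* ↧ a))       ≡⟨ fromℤ-+ T (ℤ.- (↥ x ℤ.* ↧ a)) ⟨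
      fromℤ (T ℤ.- ↥ x ℤ.* ↧ a)                 ∎
      where
      distrib : ∀ x t → (1ℚ - x) * t ≡ t - x * t
      distrib = solve-∀ ℚ-ring

  RationalRoot : ℕ → Set
  RationalRoot n = ∃[ a ] (a ≢ 0ℚ × a ≢ - 1ℚ × ∃[ x ] K a n x ≡ 0ℚ)

  rationalRoot⇒integral : RationalRoot n → IntegralSolution n
  rationalRoot⇒integral {n} (a , a≢0 , a≢-1 , x , root) =
    u , v , w , Equivalence.to (K≡0⇔ c n) root ,
    a≢0 ∘ Equivalence.from (a≡0⇔w≡0 c) , a≢-1 ∘ Equivalence.from (a≡-1⇔sum≡0 c)
    where
    c : DenominatorClearing a x
    c = common-denominator a x
    open DenominatorClearing c

  integral⇒rationalRoot : IsOdd n → IntegralSolution n → RationalRoot n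
  integral⇒rationalRoot {n} odd (u , v , w , eq , w≢0 , sum≢0) =
    a , w≢0 ∘ Equivalence.to (a≡0⇔w≡0 c) , sum≢0 ∘ Equivalence.to (a≡-1⇔sum≡0 c) , x , Equivalence.from (K≡0⇔ c n) eq
    where
    open ≡-Reasoning
    t : ℚ
    t = fromℤ (u ℤ.+ v)
    t≢0 : t ≢ 0ℚ
    t≢0 = ^-odd-sum≡0⇒≢0 odd eq w≢0 ∘ fromℤ-injective
    instance
      t-nonZero : NonZero t
      t-nonZero = ≢-nonZero t≢0
    x a : ℚ
    x = fromℤ u * 1/ t
    a = fromℤ w * 1/ t
    ÷t*t : ∀ p → p * 1/ t * t ≡ p
    ÷t*t p = trans (*-assoc p (1/ t) t) (trans (cong (p *_) (*-inverseˡ t)) (*-identityʳ p))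
    [1-x]*t : (1ℚ - x) * t ≡ fromℤ v
    [1-x]*t = begin
      (1ℚ - x) * t                  ≡⟨ distrib x t ⟩
      t - x * t                     ≡⟨ cong (λ p → t - p) (÷t*t (fromℤ u)) ⟩
      t - fromℤ u                   ≡⟨ cong (_- fromℤ u) (fromℤ-+ u v) ⟩
      fromℤ u + fromℤ v - fromℤ u   ≡⟨ cancel (fromℤ u) (fromℤ v) ⟩
      fromℤ v                       ∎
      where
      distrib : ∀ x t → (1ℚ - x) * t ≡ t - x * t
      distrib = solve-∀ ℚ-ring
      cancel : ∀ p q → p + q - p ≡ q
      cancel = solve-∀ ℚ-ring
    c : DenominatorClearing a x
    c = record { t = t ; t≢0 = t≢0 ; u = u ; v = v ; w = w
               ; x*t = ÷t*t (fromℤ u) ; [1-x]*t = [1-x]*t ; a*t = ÷t*t (fromℤ w) }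

open import Data.Nat using (_+_; _^_; _>_; _≤_; z<s)
open import Data.Nat.Properties using (<⇒≤; <-trans)
open import Data.Rational using (0ℚ; 1ℚ; -_)
open import Data.Product using (∃-syntax; _×_; _,_)
open import Function.Bundles using (_⇔_; mk⇔)
open import Relation.Binary.PropositionalEquality using (_≡_; _≢_)
open Fermat using (odd-exponent-solution)
open IntegerSolutions using (integral⇒fermat; fermat⇒integral)
open RationalRoots using (rationalRoot⇒integral; integral⇒rationalRoot)

mainTheorem1 : (∃[ a ] ∃[ n ] (a ≢ 0ℚ × a ≢ (- 1ℚ) × n > 0 × IsOdd n × ∃[ x ] K a n x ≡ 0ℚ))
    ⇔ (∃[ m ] ∃[ X ] ∃[ Y ] ∃[ Z ] (m > 2 × 1 ≤ X × 1 ≤ Y × 1 ≤ Z × X ^ m + Y ^ m ≡ Z ^ m))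
mainTheorem1 = mk⇔
  (λ (a , n , a≢0 , a≢-1 , _ , odd , x , root) →
    let n>2 , X , Y , Z , sol = integral⇒fermat odd (rationalRoot⇒integral {n} (a , a≢0 , a≢-1 , x , root))
    in n , X , Y , Z , n>2 , sol)
  (λ (m , X , Y , Z , m>2 , sol) →
    let n , odd , n>2 , sol′      = odd-exponent-solution m>2 (X , Y , Z , sol)
        a , a≢0 , a≢-1 , x , root = integral⇒rationalRoot odd (fermat⇒integral odd (<⇒≤ n>2) sol′)
    in a , n , a≢0 , a≢-1 , <-trans z<s n>2 , odd , x , root)
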